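{- Let $\mathbb{F}$ be the finite field with $q$ elements, let $b\ge 1$, and let $U_b$ be the set of $b\times\mathbb{N}$ matrices over $\mathbb{F}$ (columns indexed by $\mathbb{N}=\{0,1,2,\dots\}$) of rank $b$. Let $M\in U_b$ and $\vec c\in\mathbb{F}^b$, and put $L=[\vec c\ M]$ (the matrix whose column $0$ is $\vec c$ and whose column $i+1$ is column $i$ of $M$), which again lies in $U_b$. Then $\sigma(L)\to\sigma(M)$ in the juggling digraph. Moreover, if $\vec c$ is chosen uniformly at random from $\mathbb{F}^b$, then for every juggling state $\tau$ the probability that $\sigma(L)=\tau$ equals the probability that one step of the backward juggling Markov chain started at $\sigma(M)$ produces $\tau$.
   Context: A juggling state (with $b$ balls) is a $b$-element subset of $\mathbb{N}$, drawn as a semi-infinite word in $\times$ and $-$ with $\times$ exactly at the positions in the subset. The juggling digraph has an edge $\sigma\to\tau$ iff $\sigma\subseteq\{0\}\cup\{t+1: t\in\tau\}$. For $M=[\vec c_0\ \vec c_1\ \vec c_2\cdots]\in U_b$, $\sigma(M)$ is the juggling state with a $\times$ in position $i$ iff $\vec c_i$ is not in the span of $\vec c_0,\dots,\vec c_{i-1}$ (i.e., the set of pivot columns of $M$). The backward juggling Markov chain (with coin parameter $q$) acts on a state $\sigma$ as follows: flip a coin with probability of heads $1/q$ at most $b$ times, or until it comes up tails. If it never comes up tails, the new state is $\{s+1:s\in\sigma\}$ (a $-$ is attached to the front). If it comes up tails first on the $i$th flip, let $x$ be the $i$th largest element of $\sigma$; the new state is $\{0\}\cup\{s+1: s\in\sigma\setminus\{x\}\}$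 (the $i$th last $\times$ is moved to the front, leaving a $-$ in its place). -}

module Defs where

open import Level using (0ℓ)
open import Data.Nat as ℕ using (ℕ; zero; suc; _∸_; NonZero)
open import Data.Nat.Properties using (m^n≢0)
open import Data.Integer using (+_)
open import Data.Rational as ℚ using (ℚ; 0ℚ; 1ℚ)
open import Data.Fin using (Fin; opposite; toℕ)
open import Data.Vec as Vec using (Vec; []; _∷_; zipWith; replicate; removeAt; tabulate; toList)
open import Data.Vec.Properties using (≡-dec)
import Data.Vec.Membership.Propositional as VecMem
open import Data.Vec.Relation.Unary.Linked using (Linked)
open import Data.List as List using (List; length; sum)
open import Data.List.Relation.Unary.Any using (here; there)
open import Data.List.Membership.Propositional using (_∈_)
open import Data.List.Relation.Unary.Unique.Propositional using (Unique)
open import Data.Product using (Σ; ∃; _×_; _,_; proj₁)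
open import Data.Sum using (_⊎_)
open import Function.Bundles using (_⇔_)
open import Relation.Nullary using (¬_; Dec; yes; no)
open import Relation.Binary.PropositionalEquality using (_≡_; _≢_)
open import Algebra.Structures using (IsCommutativeRing)

record FiniteField : Set₁ where
  field
    Carrier : Set
    _+_ _*_ : Carrier → Carrier → Carrier
    -_      : Carrier → Carrier
    0# 1#   : Carrier
    isCommutativeRing : IsCommutativeRing _≡_ _+_ _*_ -_ 0# 1#
    0≢1     : 0# ≢ 1#
    _⁻¹     : (x : Carrier) → x ≢ 0# → Carrier
    inverse : (x : Carrier) (p : x ≢ 0#) → x * (x ⁻¹) p ≡ 1#
    elements          : List Carrier
    elements-unique   : Unique elements
    elements-complete : (x : Carrier) → x ∈ elements

  q : ℕ
  q = length elements

nonZero-length : {A : Set} {xs : List A} {x : A} → x ∈ xs → NonZero (length xs)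
nonZero-length (here _)  = _
nonZero-length (there _) = _

module _ (F : FiniteField) where
  open FiniteField F

  q-nonZero : NonZero q
  q-nonZero = nonZero-length (elements-complete 0#)

module LinAlg (F : FiniteField) (b : ℕ) where
  open FiniteField F

  Column : Set
  Column = Vec Carrier b

  Matrix : Set
  Matrix = ℕ → Column

  lincomb : {n : ℕ} → Matrix → Vec Carrier n → Column
  lincomb M []       = replicate b 0#
  lincomb M (a ∷ as) = zipWith _+_ (Vec.map (a *_) (M 0)) (lincomb (λ i → M (suc i)) as)

  InSpan : Matrix → ℕ → Column → Set
  InSpan M n v = Σ (Vec Carrier n) λ a → lincomb M a ≡ v

  -- rank b: the columns span all of F^b
  InU : Matrix → Set
  InU M = (v : Column) → ∃ λ n → InSpan M n v

  -- σ(M): i is a pivot column iff c_i ∉ span(c₀,…,c_{i-1})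
  σ : Matrix → ℕ → Set
  σ M i = ¬ InSpan M i (M i)

  cons : Column → Matrix → Matrix
  cons c M zero    = c
  cons c M (suc i) = M i

  -- uniform probability on F^b: the event P has exactly N elements and p = N / q^b
  HasCard : (Column → Set) → ℕ → Set
  HasCard P N = Σ (List Column) λ xs →
    Unique xs × length xs ≡ N × ((c : Column) → P c ⇔ (c ∈ xs))

  UniformProb : (Column → Set) → ℚ → Set
  UniformProb P p = ∃ λ N → HasCard P N ×
    (+ N) ℚ./ (q ℕ.^ b) ≡ p
    where instance _ = m^n≢0 q b {{q-nonZero F}}

-- a juggling state with b balls, as the strictly increasing list of its
-- b positions (its ×'s)
JState : ℕ → Set
JState b = Σ (Vec ℕ b) (Linked ℕ._<_)

_∈ₛ_ : {b : ℕ} → ℕ → JState b → Set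
n ∈ₛ s = VecMem._∈_ n (proj₁ s)

Represents : {b : ℕ} → (ℕ → Set) → JState b → Set
Represents S s = (n : ℕ) → S n ⇔ (n ∈ₛ s)

Edge : (ℕ → Set) → (ℕ → Set) → Set
Edge S T = (s : ℕ) → S s → s ≡ 0 ⊎ ∃ λ t → T t × s ≡ suc t

powℚ : ℚ → ℕ → ℚ
powℚ x zero    = 1ℚ
powℚ x (suc n) = x ℚ.* powℚ x n

module Chain (q : ℕ) .{{_ : NonZero q}} where

  h : ℚ
  h = (+ 1) ℚ./ q

  -- list of (probability, resulting position list) of all coin outcomes
  outcomes : {b : ℕ} → Vec ℕ b → List (ℚ × Vec ℕ b)
  outcomes {zero}  s = (1ℚ , Vec.map suc s) List.∷ List.[]
  outcomes {suc n} s =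
    -- never tails (b heads): attach a − to the front
    (powℚ h (suc n) , Vec.map suc s) List.∷
    -- first tails on flip i = k+1: move the i-th largest × (index n-k) to the front
    toList (tabulate λ (k : Fin (suc n)) →
      (powℚ h (toℕ k) ℚ.* (1ℚ ℚ.- h) ,
       0 ∷ Vec.map suc (removeAt s (opposite k))))

  stepProb : {b : ℕ} → JState b → JState b → ℚ
  stepProb (s , _) (t , _) =
    sum' (List.map (λ { (p , u) → select p u }) (outcomes s))
    where
      select : ℚ → Vec ℕ _ → ℚ
      select p u with ≡-dec ℕ._≟_ u t
      ... | yes _ = p
      ... | no _  = 0ℚ
      sum' : List ℚ → ℚ
      sum' = List.foldr ℚ._+_ 0ℚ

-- Let s_0 < ⋯ < s_{b-1} be the pivots of M and V t the span of its first t
-- columns.  The pivot columns form a basis, so each column is uniquely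
-- c = Φ a = Σ a_j M(s_j).  If j is the leading index of a (largest j with
-- a_j ≠ 0) then c ∈ V(s_j + 1) ∖ V(s_j), and comparing span(c, M_0, …, M_{t-1})
-- with V t shows: σ([c M]) is σ(M) shifted by one, with ball s_j moved to
-- position 0 when a ≠ 0.  Exactly (q-1)q^j vectors have leading index j and
-- only a = 0 has none; in the chain, first tails on flip k+1 has probability
-- q^{-k}(1 - 1/q) = (q-1)q^{b-1-k}/q^b and moves ball s_{b-1-k}.

module Submission where

open import Defs
open import Level using (0ℓ)
open import Data.Nat as Nat using (ℕ; zero; suc; _∸_; _≤_; _<_; _^_; NonZero; z≤n; s≤s)
import Data.Nat.Properties as ℕP
open import Data.Fin as Fin using (Fin; toℕ; opposite)
open import Data.Vec as Vec using (Vec; []; _∷_; zipWith; replicate; lookup; removeAt; _∷ʳ_; initLast)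
import Data.Vec.Properties as VecP
import Data.Fin.Properties as FinP
import Data.Fin.Permutation as Perm
open import Data.Vec.Relation.Unary.Any as VAny using (here; there)
import Data.Vec.Relation.Unary.Any.Properties as VAnyP
import Data.Vec.Relation.Unary.All as VAll
open VAll using (All; []; _∷_)
import Data.Vec.Relation.Unary.All.Properties as VAllP
open import Data.Vec.Relation.Unary.AllPairs as AllPairs using (AllPairs; []; _∷_)
import Data.Vec.Relation.Unary.AllPairs.Properties as AllPairsP
open import Data.Vec.Relation.Unary.Linked using (Linked; []; [-]; _∷_)
import Data.Vec.Relation.Unary.Linked.Properties as LinkedP
import Data.Vec.Membership.Propositional as VecMem
open import Data.Vec.Membership.Propositional.Properties using (∈-lookup; ∈-map⁺)
import Data.Vec.Membership.DecPropositional as VecDecMem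
open import Data.List as List using (List; length; cartesianProductWith; filter)
import Data.List.Properties as ListP
open import Data.Nat.ListAction using (sum)
open import Data.Nat.ListAction.Properties using (sum-++)
open import Data.Nat.Tactic.RingSolver using (solve-∀)
open import Relation.Unary using (Decidable)
open import Data.List.Relation.Unary.Any as LAny using ()
open import Data.List.Relation.Unary.All as LAll using ()
open import Data.List.Relation.Unary.AllPairs using ([]; _∷_)
open import Data.List.Membership.Propositional using (_∈_)
open import Data.List.Membership.Propositional.Properties
  using (∈-cartesianProductWith⁺; ∈-filter⁺; ∈-filter⁻)
  renaming (∈-map⁺ to ∈-map⁺ₗ; ∈-map⁻ to ∈-map⁻ₗ)
open import Data.List.Relation.Unary.Unique.Propositional using (Unique)
import Data.List.Relation.Unary.Unique.Propositional.Properties as UniqueP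
open import Data.Product using (Σ; ∃; _×_; _,_; proj₁; proj₂)
open import Data.Sum using (inj₁; inj₂)
open import Data.Maybe using (Maybe; just; nothing)
open import Data.Empty using (⊥-elim)
open import Function.Bundles using (_⇔_; mk⇔; Equivalence)
open import Function.Construct.Composition using (_⇔-∘_)
open import Function.Construct.Symmetry using (⇔-sym)
open import Function.Related.TypeIsomorphisms using (¬-cong-⇔)
open import Relation.Nullary using (¬_; Dec; yes; no; does)
open import Data.Bool using (if_then_else_)
open import Relation.Binary.Definitions using (tri<; tri≈; tri>)
open import Relation.Binary.PropositionalEquality
import Data.Integer as ℤ
import Data.Integer.Properties as ℤP
import Data.Integer.Tactic.RingSolver as ℤSolver
open import Data.Rational as ℚ using (ℚ; 0ℚ; 1ℚ; _/_; toℚᵘ; fromℚᵘ)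
import Data.Rational.Properties as ℚP
open import Data.Rational.Unnormalised as ℚᵘ using (ℚᵘ; mkℚᵘ)
import Data.Rational.Unnormalised.Properties as ℚᵘP
open import Algebra.Bundles using (CommutativeRing)

-- A duplicate-free list containing x and y decides whether x ≡ y; this
-- makes equality on a finite field decidable.
≟-in-unique : {A : Set} {xs : List A} → Unique xs → ∀ {x y} → x ∈ xs → y ∈ xs → Dec (x ≡ y)
≟-in-unique (_ ∷ _)    (LAny.here refl) (LAny.here refl) = yes refl
≟-in-unique (x∉xs ∷ _) (LAny.here refl) (LAny.there y∈xs) = no (LAll.lookup x∉xs y∈xs)
≟-in-unique (x∉xs ∷ _) (LAny.there x∈xs) (LAny.here refl) = no (λ x≡y → LAll.lookup x∉xs x∈xs (sym x≡y))
≟-in-unique (_ ∷ u)    (LAny.there x∈xs) (LAny.there y∈xs) = ≟-in-unique u x∈xs y∈xs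

module ListSums where
  open Nat using (_+_; _*_)

  indicator : {A : Set} → Dec A → ℕ
  indicator (yes _) = 1
  indicator (no _)  = 0

  length-filter : {A : Set} {P : A → Set} (P? : Decidable P) (xs : List A) →
                  length (filter P? xs) ≡ sum (List.map (λ x → indicator (P? x)) xs)
  length-filter P? List.[]        = refl
  length-filter P? (x List.∷ xs) with P? x
  ... | yes _ = cong suc (length-filter P? xs)
  ... | no _  = length-filter P? xs

  sum-cartesianProduct : ∀ {A B C : Set} (f : A → B → C) (H : C → ℕ) xs ys →
    sum (List.map H (cartesianProductWith f xs ys)) ≡ sum (List.map (λ x → sum (List.map (λ y → H (f x y)) ys)) xs)
  sum-cartesianProduct f H List.[]        ys = refl
  sum-cartesianProduct f H (x List.∷ xs) ys = begin
    sum (List.map H (List.map (f x) ys List.++ cartesianProductWith f xs ys))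
      ≡⟨ cong sum (ListP.map-++ H (List.map (f x) ys) _) ⟩
    sum (List.map H (List.map (f x) ys) List.++ List.map H (cartesianProductWith f xs ys))
      ≡⟨ sum-++ (List.map H (List.map (f x) ys)) _ ⟩
    sum (List.map H (List.map (f x) ys)) + sum (List.map H (cartesianProductWith f xs ys))
      ≡⟨ cong₂ _+_ (cong sum (sym (ListP.map-∘ ys))) (sum-cartesianProduct f H xs ys) ⟩
    sum (List.map (λ y → H (f x y)) ys) + sum (List.map (λ x → sum (List.map (λ y → H (f x y)) ys)) xs) ∎
    where open ≡-Reasoning

  sum-map-+ : ∀ {A : Set} (f : A → ℕ) c xs → sum (List.map (λ x → f x + c) xs) ≡ sum (List.map f xs) + length xs * c
  sum-map-+ f c List.[]        = refl
  sum-map-+ f c (x List.∷ xs) =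
    trans (cong (f x + c +_) (sum-map-+ f c xs)) (rearrange (f x) c (sum (List.map f xs)) (length xs * c))
    where
    rearrange : ∀ a c s t → a + c + (s + t) ≡ a + s + (c + t)
    rearrange = solve-∀

open ListSums

module Vectors (F : FiniteField) where
  open FiniteField F using (Carrier; isCommutativeRing; _⁻¹; inverse; elements; elements-unique; elements-complete)

  ring : CommutativeRing 0ℓ 0ℓ
  ring = record { isCommutativeRing = isCommutativeRing }

  open CommutativeRing ring public using (_+_; _*_; -_; 0#; 1#)
  open CommutativeRing ring using
    (+-comm; +-assoc; +-identityˡ; +-identityʳ; *-comm; *-assoc; *-identityˡ;
     zeroˡ; zeroʳ; distribˡ; distribʳ; -‿inverseˡ; -‿inverseʳ)

  _≟_ : (x y : Carrier) → Dec (x ≡ y)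
  x ≟ y = ≟-in-unique elements-unique (elements-complete x) (elements-complete y)

  open import Algebra.Properties.Ring (CommutativeRing.ring ring) using (-1*x≈-x)
  open import Algebra.Properties.CommutativeSemigroup (CommutativeRing.+-commutativeSemigroup ring)
    using (interchange)

  add-sub : ∀ x y → (x + y) + (- 1#) * y ≡ x
  add-sub x y = begin
    (x + y) + (- 1#) * y ≡⟨ cong ((x + y) +_) (-1*x≈-x y) ⟩
    (x + y) + - y        ≡⟨ +-assoc x y (- y) ⟩
    x + (y + - y)        ≡⟨ cong (x +_) (-‿inverseʳ y) ⟩
    x + 0#               ≡⟨ +-identityʳ x ⟩
    x                    ∎
    where open ≡-Reasoning

  sub-add : ∀ x y → (x + (- 1#) * y) + y ≡ x
  sub-add x y = begin
    (x + (- 1#) * y) + y ≡⟨ cong (λ z → (x + z) + y) (-1*x≈-x y) ⟩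
    (x + - y) + y        ≡⟨ +-assoc x (- y) y ⟩
    x + (- y + y)        ≡⟨ cong (x +_) (-‿inverseˡ y) ⟩
    x + 0#               ≡⟨ +-identityʳ x ⟩
    x                    ∎
    where open ≡-Reasoning

  x⁻¹*x : ∀ x (x≢0 : x ≢ 0#) → (x ⁻¹) x≢0 * x ≡ 1#
  x⁻¹*x x x≢0 = trans (*-comm _ x) (inverse x x≢0)

  infixl 6 _⊕_ _⊖_
  infixr 7 _·_

  _⊕_ : ∀ {n} → Vec Carrier n → Vec Carrier n → Vec Carrier n
  _⊕_ = zipWith _+_

  _·_ : ∀ {n} → Carrier → Vec Carrier n → Vec Carrier n
  a · v = Vec.map (a *_) v

  _⊖_ : ∀ {n} → Vec Carrier n → Vec Carrier n → Vec Carrier n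
  u ⊖ v = u ⊕ (- 1#) · v

  𝟘 : ∀ {n} → Vec Carrier n
  𝟘 {n} = replicate n 0#

  ⊕-identityˡ : ∀ {n} (u : Vec Carrier n) → 𝟘 ⊕ u ≡ u
  ⊕-identityˡ []      = refl
  ⊕-identityˡ (x ∷ u) = cong₂ _∷_ (+-identityˡ x) (⊕-identityˡ u)

  ⊕-identityʳ : ∀ {n} (u : Vec Carrier n) → u ⊕ 𝟘 ≡ u
  ⊕-identityʳ []      = refl
  ⊕-identityʳ (x ∷ u) = cong₂ _∷_ (+-identityʳ x) (⊕-identityʳ u)

  ⊕-assoc : ∀ {n} (u v w : Vec Carrier n) → (u ⊕ v) ⊕ w ≡ u ⊕ (v ⊕ w)
  ⊕-assoc []      []      []      = refl
  ⊕-assoc (x ∷ u) (y ∷ v) (z ∷ w) = cong₂ _∷_ (+-assoc x y z) (⊕-assoc u v w)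

  ⊕-comm : ∀ {n} (u v : Vec Carrier n) → u ⊕ v ≡ v ⊕ u
  ⊕-comm []      []      = refl
  ⊕-comm (x ∷ u) (y ∷ v) = cong₂ _∷_ (+-comm x y) (⊕-comm u v)

  ⊕-interchange : ∀ {n} (u v w z : Vec Carrier n) → (u ⊕ v) ⊕ (w ⊕ z) ≡ (u ⊕ w) ⊕ (v ⊕ z)
  ⊕-interchange []      []      []      []      = refl
  ⊕-interchange (x ∷ u) (y ∷ v) (x' ∷ w) (y' ∷ z) = cong₂ _∷_ (interchange x y x' y') (⊕-interchange u v w z)

  ⊕-⊖-cancel : ∀ {n} (u v : Vec Carrier n) → (u ⊕ v) ⊖ v ≡ u
  ⊕-⊖-cancel []      []      = refl
  ⊕-⊖-cancel (x ∷ u) (y ∷ v) = cong₂ _∷_ (add-sub x y) (⊕-⊖-cancel u v)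

  ⊕-⊖-cancelˡ : ∀ {n} (u v : Vec Carrier n) → (u ⊕ v) ⊖ u ≡ v
  ⊕-⊖-cancelˡ u v = trans (cong (_⊖ u) (⊕-comm u v)) (⊕-⊖-cancel v u)

  ⊖-⊕-cancel : ∀ {n} (u v : Vec Carrier n) → (u ⊖ v) ⊕ v ≡ u
  ⊖-⊕-cancel []      []      = refl
  ⊖-⊕-cancel (x ∷ u) (y ∷ v) = cong₂ _∷_ (sub-add x y) (⊖-⊕-cancel u v)

  ·-zeroˡ : ∀ {n} (u : Vec Carrier n) → 0# · u ≡ 𝟘
  ·-zeroˡ []      = refl
  ·-zeroˡ (x ∷ u) = cong₂ _∷_ (zeroˡ x) (·-zeroˡ u)

  ·-zeroʳ : ∀ {n} a → a · 𝟘 {n} ≡ 𝟘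
  ·-zeroʳ {zero}  a = refl
  ·-zeroʳ {suc n} a = cong₂ _∷_ (zeroʳ a) (·-zeroʳ a)

  ·-identityˡ : ∀ {n} (u : Vec Carrier n) → 1# · u ≡ u
  ·-identityˡ []      = refl
  ·-identityˡ (x ∷ u) = cong₂ _∷_ (*-identityˡ x) (·-identityˡ u)

  ·-distribˡ : ∀ {n} a (u v : Vec Carrier n) → a · (u ⊕ v) ≡ a · u ⊕ a · v
  ·-distribˡ a []      []      = refl
  ·-distribˡ a (x ∷ u) (y ∷ v) = cong₂ _∷_ (distribˡ a x y) (·-distribˡ a u v)

  ·-distribʳ : ∀ {n} a c (u : Vec Carrier n) → (a + c) · u ≡ a · u ⊕ c · u
  ·-distribʳ a c []      = refl
  ·-distribʳ a c (x ∷ u) = cong₂ _∷_ (distribʳ x a c) (·-distribʳ a c u)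

  ·-assoc : ∀ {n} a c (u : Vec Carrier n) → a · (c · u) ≡ (a * c) · u
  ·-assoc a c []      = refl
  ·-assoc a c (x ∷ u) = cong₂ _∷_ (sym (*-assoc a c x)) (·-assoc a c u)

  ·-unscale : ∀ {n} x (x≢0 : x ≢ 0#) (u : Vec Carrier n) → (x ⁻¹) x≢0 · (x · u) ≡ u
  ·-unscale x x≢0 u = trans (·-assoc _ x u) (trans (cong (_· u) (x⁻¹*x x x≢0)) (·-identityˡ u))

  ⊖-self : ∀ {n} (u : Vec Carrier n) → u ⊖ u ≡ 𝟘
  ⊖-self []      = refl
  ⊖-self (x ∷ u) = cong₂ _∷_ (trans (cong (x +_) (-1*x≈-x x)) (-‿inverseʳ x)) (⊖-self u)

  ⊖≡𝟘⇒≡ : ∀ {n} (u v : Vec Carrier n) → u ⊖ v ≡ 𝟘 → u ≡ v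
  ⊖≡𝟘⇒≡ u v u⊖v≡𝟘 = trans (sym (⊖-⊕-cancel u v)) (trans (cong (_⊕ v) u⊖v≡𝟘) (⊕-identityˡ v))

  unit : ∀ {m} → Fin m → Vec Carrier m
  unit {suc m} Fin.zero = 1# ∷ 𝟘
  unit (Fin.suc j)      = 0# ∷ unit j

  allVectors : ∀ m → List (Vec Carrier m)
  allVectors zero    = List.[ [] ]
  allVectors (suc m) = cartesianProductWith _∷_ elements (allVectors m)

  allVectors-complete : ∀ {m} (a : Vec Carrier m) → a ∈ allVectors m
  allVectors-complete []      = LAny.here refl
  allVectors-complete (x ∷ a) = ∈-cartesianProductWith⁺ _∷_ (elements-complete x) (allVectors-complete a)

  allVectors-unique : ∀ m → Unique (allVectors m)
  allVectors-unique zero    = LAll.[] ∷ []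
  allVectors-unique (suc m) =
    UniqueP.cartesianProductWith⁺ _∷_ VecP.∷-injective elements-unique (allVectors-unique m)

module Spans (F : FiniteField) (b : ℕ) where
  open FiniteField F using (Carrier; _⁻¹)
  open Vectors F
  open LinAlg F b

  private variable
    n t : ℕ
    M : Matrix
    u v : Column

  lincomb-𝟘 : ∀ {n} (M : Matrix) → lincomb M (𝟘 {n}) ≡ 𝟘
  lincomb-𝟘 {zero}  M = refl
  lincomb-𝟘 {suc n} M = trans (cong₂ _⊕_ (·-zeroˡ (M 0)) (lincomb-𝟘 {n} (λ i → M (suc i)))) (⊕-identityˡ 𝟘)

  lincomb-⊕ : (M : Matrix) (a c : Vec Carrier n) → lincomb M (a ⊕ c) ≡ lincomb M a ⊕ lincomb M c
  lincomb-⊕ M []      []      = sym (⊕-identityˡ 𝟘)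
  lincomb-⊕ M (x ∷ a) (y ∷ c) =
    trans (cong₂ _⊕_ (·-distribʳ x y (M 0)) (lincomb-⊕ (λ i → M (suc i)) a c))
          (⊕-interchange (x · M 0) (y · M 0) _ _)

  lincomb-· : (M : Matrix) (x : Carrier) (a : Vec Carrier n) → lincomb M (x · a) ≡ x · lincomb M a
  lincomb-· M x []      = sym (·-zeroʳ x)
  lincomb-· M x (y ∷ a) =
    trans (cong₂ _⊕_ (sym (·-assoc x y (M 0))) (lincomb-· (λ i → M (suc i)) x a))
          (sym (·-distribˡ x (y · M 0) _))

  lincomb-∷ʳ : (M : Matrix) (a : Vec Carrier n) (x : Carrier) → lincomb M (a ∷ʳ x) ≡ lincomb M a ⊕ x · M n
  lincomb-∷ʳ M []      x = trans (⊕-identityʳ _) (sym (⊕-identityˡ _))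
  lincomb-∷ʳ M (y ∷ a) x =
    trans (cong (y · M 0 ⊕_) (lincomb-∷ʳ (λ i → M (suc i)) a x)) (sym (⊕-assoc _ _ _))

  lincomb-unit : (M : Matrix) (j : Fin n) → lincomb M (unit j) ≡ M (toℕ j)
  lincomb-unit {suc n} M Fin.zero    =
    trans (cong₂ _⊕_ (·-identityˡ (M 0)) (lincomb-𝟘 {n} (λ i → M (suc i)))) (⊕-identityʳ _)
  lincomb-unit M (Fin.suc j) = trans (cong₂ _⊕_ (·-zeroˡ (M 0)) (lincomb-unit (λ i → M (suc i)) j)) (⊕-identityˡ _)

  lincomb-⊖ : (M : Matrix) (a c : Vec Carrier n) → lincomb M (a ⊖ c) ≡ lincomb M a ⊖ lincomb M c
  lincomb-⊖ M a c = trans (lincomb-⊕ M a _) (cong (lincomb M a ⊕_) (lincomb-· M (- 1#) c))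

  span-𝟘 : InSpan M n 𝟘
  span-𝟘 {M = M} {n = n} = 𝟘 , lincomb-𝟘 {n} M

  span-⊕ : InSpan M n u → InSpan M n v → InSpan M n (u ⊕ v)
  span-⊕ {M} (a , refl) (c , refl) = a ⊕ c , lincomb-⊕ M a c

  span-· : ∀ x → InSpan M n u → InSpan M n (x · u)
  span-· {M} x (a , refl) = x · a , lincomb-· M x a

  span-⊖ : InSpan M n u → InSpan M n v → InSpan M n (u ⊖ v)
  span-⊖ u∈ v∈ = span-⊕ u∈ (span-· (- 1#) v∈)

  span-cancelˡ : InSpan M n (u ⊕ v) → InSpan M n u → InSpan M n v
  span-cancelˡ {u = u} {v} u⊕v∈ u∈ = subst (InSpan _ _) (⊕-⊖-cancelˡ u v) (span-⊖ u⊕v∈ u∈)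

  span-unscale : ∀ x (x≢0 : x ≢ 0#) → InSpan M n (x · u) → InSpan M n u
  span-unscale {u = u} x x≢0 x·u∈ = subst (InSpan _ _) (·-unscale x x≢0 u) (span-· ((x ⁻¹) x≢0) x·u∈)

  span-extend : ∀ α → InSpan M t u → InSpan M (suc t) (u ⊕ α · M t)
  span-extend {M} α (a , refl) = a ∷ʳ α , lincomb-∷ʳ M a α

  span-split : InSpan M (suc t) v → ∃ λ α → ∃ λ u → InSpan M t u × v ≡ u ⊕ α · M t
  span-split {M} (a , refl) with initLast a
  ... | a' , x , refl = x , lincomb M a' , (a' , refl) , lincomb-∷ʳ M a' x

  span-suc : InSpan M t v → InSpan M (suc t) v
  span-suc {M} {t} {v} v∈ =
    subst (InSpan M (suc t)) (trans (cong (v ⊕_) (·-zeroˡ (M t))) (⊕-identityʳ v)) (span-extend 0# v∈)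

  span-mono : ∀ {s t} → s ≤ t → InSpan M s v → InSpan M t v
  span-mono s≤t = go (ℕP.≤⇒≤′ s≤t)
    where
    go : ∀ {s t} → s Nat.≤′ t → InSpan M s v → InSpan M t v
    go Nat.≤′-refl          v∈ = v∈
    go (Nat.≤′-step s≤′t) v∈ = span-suc (go s≤′t v∈)

  column-in-span : InSpan M (suc t) (M t)
  column-in-span {M} {t} =
    subst (InSpan M (suc t)) (trans (⊕-identityˡ _) (·-identityˡ (M t))) (span-extend 1# span-𝟘)

  column-in-later-span : t < n → InSpan M n (M t)
  column-in-later-span t<n = span-mono t<n column-in-span

  -- over a finite field membership in V t is decidable (try all coefficients)
  span? : ∀ M n v → Dec (InSpan M n v)
  span? M n v with LAny.any? (λ a → VecP.≡-dec _≟_ (lincomb M a) v) (allVectors n)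
  ... | yes found = yes (LAny.satisfied found)
  ... | no none   = no (λ { (a , eq) → none (LAny.map (λ { refl → eq }) (allVectors-complete a)) })

-- The first t+1 columns of [c M] span
-- W t = F·c + V t; note lincomb [c M] (α ∷ a) = α·c ⊕ lincomb M a by
-- definition.  Comparing W t with V t decides which columns of [c M] are
-- pivots.
module Prepend (F : FiniteField) (b : ℕ) where
  open FiniteField F using (Carrier; _⁻¹)
  open Vectors F
  open LinAlg F b
  open Spans F b

  private variable
    t : ℕ
    M : Matrix
    c v : Column

  W-intro : ∀ α → InSpan M t v → InSpan (cons c M) (suc t) (α · c ⊕ v)
  W-intro α (a , refl) = α ∷ a , refl

  V⊆W : InSpan M t v → InSpan (cons c M) (suc t) v
  V⊆W {v = v} {c = c} v∈ =
    subst (InSpan _ _) (trans (cong (_⊕ v) (·-zeroˡ c)) (⊕-identityˡ v)) (W-intro 0# v∈)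

  W⊆V : InSpan M t c → InSpan (cons c M) (suc t) v → InSpan M t v
  W⊆V c∈ (α ∷ a , refl) = span-⊕ (span-· α c∈) (a , refl)

  column-in-W⇒V : ¬ InSpan M (suc t) c → InSpan (cons c M) (suc t) (M t) → InSpan M t (M t)
  column-in-W⇒V {M} {t} {c} c∉ (α ∷ a , eq) with α ≟ 0#
  ... | yes refl = subst (InSpan M t) (trans (sym 0·c⊕u≡u) eq) (a , refl)
    where
    0·c⊕u≡u : 0# · c ⊕ lincomb M a ≡ lincomb M a
    0·c⊕u≡u = trans (cong (_⊕ lincomb M a) (·-zeroˡ c)) (⊕-identityˡ _)
  ... | no α≢0 = ⊥-elim (c∉ (span-unscale α α≢0 (subst (InSpan M (suc t)) Mt⊖u≡α·c
                   (span-⊖ column-in-span (span-suc (a , refl))))))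
    where
    Mt⊖u≡α·c : M t ⊖ lincomb M a ≡ α · c
    Mt⊖u≡α·c = trans (cong (_⊖ lincomb M a) (sym eq)) (⊕-⊖-cancel (α · c) _)

  column-in-W : ¬ InSpan M t c → InSpan M (suc t) c → InSpan (cons c M) (suc t) (M t)
  column-in-W {M} {t} {c} c∉ c∈ with span-split c∈
  ... | β , u , u∈ , c≡ with β ≟ 0#
  ...   | yes refl = ⊥-elim (c∉ (subst (InSpan M t) (sym c≡u) u∈))
    where
    c≡u : c ≡ u
    c≡u = trans c≡ (trans (cong (u ⊕_) (·-zeroˡ (M t))) (⊕-identityʳ u))
  ...   | no β≢0 = subst (InSpan _ _) eq (W-intro β⁻¹ (span-· β⁻¹ (span-· (- 1#) u∈)))
    where
    β⁻¹ : Carrier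
    β⁻¹ = (β ⁻¹) β≢0
    eq : β⁻¹ · c ⊕ β⁻¹ · ((- 1#) · u) ≡ M t
    eq = begin
      β⁻¹ · c ⊕ β⁻¹ · ((- 1#) · u) ≡⟨ sym (·-distribˡ β⁻¹ c _) ⟩
      β⁻¹ · (c ⊖ u)                ≡⟨ cong (λ z → β⁻¹ · (z ⊖ u)) c≡ ⟩
      β⁻¹ · ((u ⊕ β · M t) ⊖ u)    ≡⟨ cong (β⁻¹ ·_) (⊕-⊖-cancelˡ u (β · M t)) ⟩
      β⁻¹ · (β · M t)              ≡⟨ ·-unscale β β≢0 (M t) ⟩
      M t                          ∎
      where open ≡-Reasoning

  pivot-cons-above : InSpan M t c → σ (cons c M) (suc t) ⇔ σ M t
  pivot-cons-above c∈ = ¬-cong-⇔ (mk⇔ (W⊆V c∈) V⊆W)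

  pivot-cons-below : ¬ InSpan M (suc t) c → σ (cons c M) (suc t) ⇔ σ M t
  pivot-cons-below c∉ = ¬-cong-⇔ (mk⇔ (column-in-W⇒V c∉) V⊆W)

  pivot-cons-at : ¬ InSpan M t c → InSpan M (suc t) c → ¬ σ (cons c M) (suc t)
  pivot-cons-at c∉ c∈ not-in-W = not-in-W (column-in-W c∉ c∈)

  cons-InU : InU M → InU (cons c M)
  cons-InU M∈U v with M∈U v
  ... | t , v∈ = suc t , V⊆W v∈

  cons-edge : Edge (σ (cons c M)) (σ M)
  cons-edge zero    _     = inj₁ refl
  cons-edge (suc t) pivot = inj₂ (t , (λ Mt∈V → pivot (V⊆W Mt∈V)) , refl)

_∈ᵥ_ : ∀ {m} → ℕ → Vec ℕ m → Set
t ∈ᵥ v = VecMem._∈_ t v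

Increasing : ∀ {m} → Vec ℕ m → Set
Increasing = AllPairs _<_

linked⇒increasing : ∀ {m} {v : Vec ℕ m} → Linked _<_ v → Increasing v
linked⇒increasing []        = []
linked⇒increasing [-]       = VAll.[] ∷ []
linked⇒increasing (x<y ∷ l) = LinkedP.Linked⇒All ℕP.<-trans x<y l ∷ linked⇒increasing l

increasing-unique : ∀ {m} (u v : Vec ℕ m) → Increasing u → Increasing v →
                    (∀ t → (t ∈ᵥ u) ⇔ (t ∈ᵥ v)) → u ≡ v
increasing-unique []      []      _              _              _    = refl
increasing-unique (x ∷ u) (y ∷ v) (x<u ∷ inc-u) (y<v ∷ inc-v) same =
  cong₂ _∷_ x≡y (increasing-unique u v inc-u inc-v same-tail)
  where
  x≡y : x ≡ y
  x≡y with Equivalence.to (same x) (here refl) | Equivalence.from (same y) (here refl)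
  ... | here x≡y  | _          = x≡y
  ... | there x∈v | here y≡x   = sym y≡x
  ... | there x∈v | there y∈u  = ⊥-elim (ℕP.<-asym (VAll.lookup y<v x∈v) (VAll.lookup x<u y∈u))
  same-tail : ∀ t → (t ∈ᵥ u) ⇔ (t ∈ᵥ v)
  same-tail t = mk⇔ to from
    where
    to : t ∈ᵥ u → t ∈ᵥ v
    to t∈u with Equivalence.to (same t) (there t∈u)
    ... | here refl = ⊥-elim (ℕP.<-irrefl x≡y (VAll.lookup x<u t∈u))
    ... | there t∈v = t∈v
    from : t ∈ᵥ v → t ∈ᵥ u
    from t∈v with Equivalence.from (same t) (there t∈v)
    ... | here refl = ⊥-elim (ℕP.<-irrefl (sym x≡y) (VAll.lookup y<v t∈v))
    ... | there t∈u = t∈u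

∈-map-suc : ∀ {m t} {v : Vec ℕ m} → (suc t ∈ᵥ Vec.map suc v) ⇔ (t ∈ᵥ v)
∈-map-suc = mk⇔ (λ st∈ → VAny.map ℕP.suc-injective (VAnyP.map⁻ st∈)) (∈-map⁺ suc)

0∉map-suc : ∀ {m} {v : Vec ℕ m} → ¬ (0 ∈ᵥ Vec.map suc v)
0∉map-suc {v = _ ∷ _} (there 0∈) = 0∉map-suc 0∈

∈-removeAt⁻ : ∀ {m t} (v : Vec ℕ (suc m)) j → t ∈ᵥ removeAt v j → t ∈ᵥ v
∈-removeAt⁻ (x ∷ xs)     Fin.zero    t∈         = there t∈
∈-removeAt⁻ (x ∷ y ∷ ys) (Fin.suc j) (here t≡x) = here t≡x
∈-removeAt⁻ (x ∷ y ∷ ys) (Fin.suc j) (there t∈) = there (∈-removeAt⁻ (y ∷ ys) j t∈)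

∈-removeAt⁺ : ∀ {m t} (v : Vec ℕ (suc m)) j → t ∈ᵥ v → t ≢ lookup v j → t ∈ᵥ removeAt v j
∈-removeAt⁺ (x ∷ xs)     Fin.zero    (here t≡x) t≢x = ⊥-elim (t≢x t≡x)
∈-removeAt⁺ (x ∷ xs)     Fin.zero    (there t∈) _   = t∈
∈-removeAt⁺ (x ∷ y ∷ ys) (Fin.suc j) (here t≡x) _   = here t≡x
∈-removeAt⁺ (x ∷ y ∷ ys) (Fin.suc j) (there t∈) t≢  = there (∈-removeAt⁺ (y ∷ ys) j t∈ t≢)

∈-removeAt-≢ : ∀ {m t} (v : Vec ℕ (suc m)) j → Increasing v → t ∈ᵥ removeAt v j → t ≢ lookup v j
∈-removeAt-≢ (x ∷ xs)     Fin.zero    (x<xs ∷ _) t∈         refl = ℕP.<-irrefl refl (VAll.lookup x<xs t∈)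
∈-removeAt-≢ (x ∷ y ∷ ys) (Fin.suc j) (x<ys ∷ _) (here refl) t≡ =
  ℕP.<-irrefl t≡ (VAll.lookup x<ys (∈-lookup j (y ∷ ys)))
∈-removeAt-≢ (x ∷ y ∷ ys) (Fin.suc j) (_ ∷ inc)  (there t∈) = ∈-removeAt-≢ (y ∷ ys) j inc t∈

∈-removeAt : ∀ {m t} (v : Vec ℕ (suc m)) j → Increasing v →
             (t ∈ᵥ removeAt v j) ⇔ ((t ∈ᵥ v) × t ≢ lookup v j)
∈-removeAt v j inc =
  mk⇔ (λ t∈ → ∈-removeAt⁻ v j t∈ , ∈-removeAt-≢ v j inc t∈)
      (λ (t∈ , t≢) → ∈-removeAt⁺ v j t∈ t≢)

all-removeAt : ∀ {P : ℕ → Set} {m} (v : Vec ℕ (suc m)) j → All P v → All P (removeAt v j)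
all-removeAt (x ∷ xs)     Fin.zero    (_ ∷ pxs)  = pxs
all-removeAt (x ∷ y ∷ ys) (Fin.suc j) (px ∷ pxs) = px ∷ all-removeAt (y ∷ ys) j pxs

increasing-removeAt : ∀ {m} (v : Vec ℕ (suc m)) j → Increasing v → Increasing (removeAt v j)
increasing-removeAt (x ∷ xs)     Fin.zero    (_ ∷ inc)    = inc
increasing-removeAt (x ∷ y ∷ ys) (Fin.suc j) (x<ys ∷ inc) =
  all-removeAt (y ∷ ys) j x<ys ∷ increasing-removeAt (y ∷ ys) j inc

increasing-map-suc : ∀ {m} {v : Vec ℕ m} → Increasing v → Increasing (Vec.map suc v)
increasing-map-suc inc = AllPairsP.map⁺ (AllPairs.map s≤s inc)

-- the successor of the state s: either every ball moves down one position
-- (nothing), or in addition ball j is rethrown to position 0 (just j)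
nextState : ∀ {m} → Vec ℕ m → Maybe (Fin m) → Vec ℕ m
nextState         s nothing  = Vec.map suc s
nextState {suc _} s (just j) = 0 ∷ Vec.map suc (removeAt s j)

increasing-nextState : ∀ {m} (s : Vec ℕ m) r → Increasing s → Increasing (nextState s r)
increasing-nextState         s nothing  inc = increasing-map-suc inc
increasing-nextState {suc _} s (just j) inc =
  VAllP.map⁺ (VAll.universal (λ _ → s≤s z≤n) _) ∷ increasing-map-suc (increasing-removeAt s j inc)

hits : ∀ {m} → Vec ℕ m → Vec ℕ m → Maybe (Fin m) → ℕ
hits s τ r = indicator (VecP.≡-dec Nat._≟_ (nextState s r) τ)

-- The leading index of a coefficient vector a ∈ F^m: the largest j with
-- a_j ≠ 0, or nothing for a = 0.
module LeadingIndex (F : FiniteField) where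
  open FiniteField F using (Carrier)
  open Vectors F

  leadingHead : ∀ {m} → Carrier → Maybe (Fin (suc m))
  leadingHead x with x ≟ 0#
  ... | yes _ = nothing
  ... | no _  = just Fin.zero

  leadingHead-cases : ∀ {m} (P : Maybe (Fin (suc m)) → Set) x →
                      (x ≡ 0# → P nothing) → (x ≢ 0# → P (just Fin.zero)) → P (leadingHead x)
  leadingHead-cases P x zero-case nonzero-case with x ≟ 0#
  ... | yes x≡0 = zero-case x≡0
  ... | no x≢0  = nonzero-case x≢0

  extendLeading : ∀ {m} → Carrier → Maybe (Fin m) → Maybe (Fin (suc m))
  extendLeading x (just j) = just (Fin.suc j)
  extendLeading x nothing  = leadingHead x

  leading : ∀ {m} → Vec Carrier m → Maybe (Fin m)
  leading []      = nothing
  leading (x ∷ a) = extendLeading x (leading a)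

  leading-nothing : ∀ {m} (a : Vec Carrier m) → leading a ≡ nothing → a ≡ 𝟘
  leading-nothing []      _ = refl
  leading-nothing (x ∷ a) eq with leading a in leading-a
  ... | nothing = leadingHead-cases (λ r → r ≡ nothing → x ∷ a ≡ 𝟘) x
                    (λ x≡0 _ → cong₂ _∷_ x≡0 (leading-nothing a leading-a)) (λ _ ()) eq

-- For increasing pivot
-- positions ps the combination Σ a_j M(ps_j) enters the flag of spans
-- exactly at the pivot position of the leading index of a.
module PivotCoordinates (F : FiniteField) (b : ℕ) (M : LinAlg.Matrix F b) where
  open FiniteField F using (Carrier)
  open Vectors F
  open LinAlg F b
  open Spans F b
  open LeadingIndex F

  -- the matrix whose columns are M(ps_0), M(ps_1), … (then zero)
  selectColumns : ∀ {m} → Vec ℕ m → Matrix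
  selectColumns []       _       = 𝟘
  selectColumns (p ∷ ps) zero    = M p
  selectColumns (p ∷ ps) (suc i) = selectColumns ps i

  combination : ∀ {m} → Vec ℕ m → Vec Carrier m → Column
  combination ps = lincomb (selectColumns ps)

  combination-unit : ∀ {m} (ps : Vec ℕ m) j → combination ps (unit j) ≡ M (lookup ps j)
  combination-unit ps j = trans (lincomb-unit (selectColumns ps) j) (select-lookup ps j)
    where
    select-lookup : ∀ {m} (ps : Vec ℕ m) j → selectColumns ps (toℕ j) ≡ M (lookup ps j)
    select-lookup (p ∷ ps) Fin.zero    = refl
    select-lookup (p ∷ ps) (Fin.suc j) = select-lookup ps j

  FlagPosition : ∀ {m} → Vec ℕ m → Maybe (Fin m) → Column → Set
  FlagPosition ps nothing  v = v ≡ 𝟘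
  FlagPosition ps (just j) v = ¬ InSpan M (lookup ps j) v × InSpan M (suc (lookup ps j)) v

  flagPosition : ∀ {m} (ps : Vec ℕ m) → Increasing ps → (∀ {p} → p ∈ᵥ ps → σ M p) →
                 (a : Vec Carrier m) → FlagPosition ps (leading a) (combination ps a)
  flagPosition []       _             _      []      = refl
  flagPosition (p ∷ ps) (p<ps ∷ inc) pivot (x ∷ a) =
    extend (leading a) (flagPosition ps inc (λ p∈ → pivot (there p∈)) a)
    where
    -- combination (p ∷ ps) (x ∷ a) = x · M p ⊕ combination ps a
    extend : (r : Maybe (Fin _)) → FlagPosition ps r (combination ps a) →
             FlagPosition (p ∷ ps) (extendLeading x r) (x · M p ⊕ combination ps a)
    extend (just j) (v∉ , v∈) = (λ w∈ → v∉ (span-cancelˡ w∈ xMp∈)) , span-⊕ (span-suc xMp∈) v∈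
      where
      xMp∈ : InSpan M (lookup ps j) (x · M p)
      xMp∈ = span-· x (column-in-later-span (VAll.lookup p<ps (∈-lookup j ps)))
    extend nothing v≡𝟘 rewrite v≡𝟘 = leadingHead-cases
      (λ r → FlagPosition (p ∷ ps) r (x · M p ⊕ 𝟘)) x
      (λ x≡0 → trans (⊕-identityʳ _) (trans (cong (_· M p) x≡0) (·-zeroˡ (M p))))
      (λ x≢0 → (λ w∈ → pivot (here refl) (span-unscale x x≢0 (subst (InSpan M p) (⊕-identityʳ _) w∈))) ,
               subst (InSpan M (suc p)) (sym (⊕-identityʳ _)) (span-· x column-in-span))

-- When s lists exactly the pivots of M, a ↦ Φ a = Σ a_j M(s_j) is a
-- bijection F^b → F^b, and the pivots of [Φ a  M] are nextState s (leading a).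
-- (Stated for b = n + 1, where nextState s (just j) is defined.)
module PivotBasis (F : FiniteField) (n : ℕ) (M : LinAlg.Matrix F (suc n)) (s : Vec ℕ (suc n))
                  (s-increasing : Increasing s) (s-pivots : ∀ t → LinAlg.σ F (suc n) M t ⇔ (t ∈ᵥ s)) where
  open FiniteField F using (Carrier)

  b : ℕ
  b = suc n

  open Vectors F
  open LinAlg F b
  open Spans F b
  open Prepend F b
  open LeadingIndex F
  open PivotCoordinates F b M

  Φ : Vec Carrier b → Column
  Φ = combination s

  Φ-flagPosition : ∀ a → FlagPosition s (leading a) (Φ a)
  Φ-flagPosition = flagPosition s s-increasing (λ {p} → Equivalence.from (s-pivots p))

  -- surjectivity: by induction along the flag, every column of M, and hence
  -- every vector of every V t, is a combination of pivot columns
  span⊆image : ∀ t {v} → InSpan M t v → ∃ λ a → Φ a ≡ v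
  column∈image : ∀ t → ∃ λ a → Φ a ≡ M t

  span⊆image zero    ([] , refl) = 𝟘 , lincomb-𝟘 {b} (selectColumns s)
  span⊆image (suc t) v∈ with span-split v∈
  ... | α , u , u∈ , refl with span⊆image t u∈ | column∈image t
  ...   | a , refl | e , Φe≡Mt =
          a ⊕ α · e , trans (lincomb-⊕ _ a _) (cong (Φ a ⊕_) (trans (lincomb-· _ α e) (cong (α ·_) Φe≡Mt)))

  column∈image t with VecDecMem._∈?_ Nat._≟_ t s
  ... | yes t∈s = unit (VAny.index t∈s) ,
                  trans (combination-unit s _) (cong M (sym (VAnyP.lookup-index t∈s)))
  ... | no t∉s with span? M t (M t)
  ...   | yes Mt∈ = span⊆image t Mt∈
  ...   | no Mt∉  = ⊥-elim (t∉s (Equivalence.to (s-pivots t) Mt∉))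

  Φ-surjective : InU M → ∀ v → ∃ λ a → Φ a ≡ v
  Φ-surjective M∈U v = span⊆image _ (proj₂ (M∈U v))

  -- injectivity: a non-zero a has Φ a outside some V t, so Φ a ≠ 0
  Φ-kernel : ∀ a → Φ a ≡ 𝟘 → a ≡ 𝟘
  Φ-kernel a Φa≡𝟘 with leading a in leading-a | Φ-flagPosition a
  ... | nothing | _        = leading-nothing a leading-a
  ... | just j  | Φa∉ , _  = ⊥-elim (Φa∉ (subst (InSpan M _) (sym Φa≡𝟘) span-𝟘))

  Φ-injective : ∀ a c → Φ a ≡ Φ c → a ≡ c
  Φ-injective a c Φa≡Φc = ⊖≡𝟘⇒≡ a c (Φ-kernel (a ⊖ c) (begin
    Φ (a ⊖ c)   ≡⟨ lincomb-⊖ _ a c ⟩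
    Φ a ⊖ Φ c   ≡⟨ cong (_⊖ Φ c) Φa≡Φc ⟩
    Φ c ⊖ Φ c   ≡⟨ ⊖-self (Φ c) ⟩
    𝟘           ∎))
    where open ≡-Reasoning

  pivots-cons : ∀ a t → σ (cons (Φ a) M) t ⇔ (t ∈ᵥ nextState s (leading a))
  pivots-cons a t with leading a | Φ-flagPosition a
  pivots-cons a zero    | nothing | Φa≡𝟘 =
    mk⇔ (λ pivot → ⊥-elim (pivot ([] , sym Φa≡𝟘))) (λ 0∈ → ⊥-elim (0∉map-suc 0∈))
  pivots-cons a (suc t) | nothing | Φa≡𝟘 =
    ⇔-sym ∈-map-suc ⇔-∘ (s-pivots t ⇔-∘ pivot-cons-above (subst (InSpan M t) (sym Φa≡𝟘) span-𝟘))
  pivots-cons a zero    | just j  | Φa∉ , _ =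
    mk⇔ (λ _ → here refl) (λ { _ ([] , 𝟘≡Φa) → Φa∉ (subst (InSpan M _) 𝟘≡Φa span-𝟘) })
  pivots-cons a (suc t) | just j  | Φa∉ , Φa∈ =
    mk⇔ there drop-0 ⇔-∘ (⇔-sym ∈-map-suc ⇔-∘ (⇔-sym (∈-removeAt s j s-increasing) ⇔-∘ pivot-unless-moved))
    where
    drop-0 : ∀ {m} {v : Vec ℕ m} → suc t ∈ᵥ (0 ∷ v) → suc t ∈ᵥ v
    drop-0 (there st∈) = st∈
    pivot-unless-moved : σ (cons (Φ a) M) (suc t) ⇔ ((t ∈ᵥ s) × t ≢ lookup s j)
    pivot-unless-moved with ℕP.<-cmp t (lookup s j)
    ... | tri< t<P _ _ = mk⇔ (λ pivot → Equivalence.to below pivot , ℕP.<⇒≢ t<P)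
                             (λ (pivot , _) → Equivalence.from below pivot)
      where
      below : σ (cons (Φ a) M) (suc t) ⇔ (t ∈ᵥ s)
      below = s-pivots t ⇔-∘ pivot-cons-below (λ Φa∈Vt+1 → Φa∉ (span-mono t<P Φa∈Vt+1))
    ... | tri≈ _ refl _ = mk⇔ (λ pivot → ⊥-elim (pivot-cons-at Φa∉ Φa∈ pivot))
                              (λ (_ , t≢t) → ⊥-elim (t≢t refl))
    ... | tri> _ _ P<t = mk⇔ (λ pivot → Equivalence.to above pivot , ℕP.>⇒≢ P<t)
                             (λ (pivot , _) → Equivalence.from above pivot)
      where
      above : σ (cons (Φ a) M) (suc t) ⇔ (t ∈ᵥ s)
      above = s-pivots t ⇔-∘ pivot-cons-above (span-mono P<t Φa∈)

-- (q - 1) q^j: the number of vectors in F^m with leading index j when |F| = q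
leadingWeight : ∀ {m} → ℕ → Fin m → ℕ
leadingWeight q j = (q ∸ 1) Nat.* q ^ toℕ j

-- Counting coefficient vectors by leading index: a ∈ F^m has leading index
-- j for exactly (q - 1) q^j vectors, and leading index nothing only for 0.
-- The count is phrased as a sum of an arbitrary weight G over F^m.
module Counting (F : FiniteField) where
  open Nat using (_+_; _*_)
  open FiniteField F using (q; elements; elements-unique; elements-complete)
  open Vectors F using (0#; allVectors)
  open LeadingIndex F
  open import Algebra.Properties.Semiring.Sum ℕP.+-*-semiring using (*-distribˡ-sum; sum-cong-≗)
    renaming (sum to ∑)

  weight : ∀ {m} → Fin m → ℕ
  weight = leadingWeight q

  leadingHead-nonzero : ∀ {m} x → x ≢ 0# → leadingHead {m} x ≡ just Fin.zero
  leadingHead-nonzero x x≢0 = leadingHead-cases (_≡ just Fin.zero) x (λ x≡0 → ⊥-elim (x≢0 x≡0)) (λ _ → refl)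

  leadingHead-zero : ∀ {m} → leadingHead {m} 0# ≡ nothing
  leadingHead-zero = leadingHead-cases (_≡ nothing) 0# (λ _ → refl) (λ 0≢0 → ⊥-elim (0≢0 refl))

  module _ {m} (G : Maybe (Fin (suc m)) → ℕ) where
    sum-leadingHead-nonzero : ∀ xs → LAll.All (_≢ 0#) xs →
      sum (List.map (λ x → G (leadingHead x)) xs) ≡ length xs * G (just Fin.zero)
    sum-leadingHead-nonzero List.[]        _                 = refl
    sum-leadingHead-nonzero (x List.∷ xs) (x≢0 LAll.∷ xs≢0) =
      cong₂ _+_ (cong G (leadingHead-nonzero x x≢0)) (sum-leadingHead-nonzero xs xs≢0)

    sum-leadingHead : ∀ xs → Unique xs → 0# ∈ xs →
      sum (List.map (λ x → G (leadingHead x)) xs) ≡ G nothing + (length xs ∸ 1) * G (just Fin.zero)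
    sum-leadingHead (x List.∷ xs) (x∉xs ∷ _) (LAny.here refl) =
      cong₂ _+_ (cong G leadingHead-zero)
                (sum-leadingHead-nonzero xs (LAll.map (λ 0≢y y≡0 → 0≢y (sym y≡0)) x∉xs))
    sum-leadingHead (x List.∷ y List.∷ ys) (x∉xs ∷ u) (LAny.there 0∈) =
      trans (cong₂ _+_ (cong G (leadingHead-nonzero x (LAll.lookup x∉xs 0∈))) (sum-leadingHead (y List.∷ ys) u 0∈))
            (rearrange (G (just Fin.zero)) (G nothing) (length ys))
      where
      rearrange : ∀ g h k → g + (h + k * g) ≡ h + (g + k * g)
      rearrange = solve-∀

  count-by-leading : ∀ m (G : Maybe (Fin m) → ℕ) →
    sum (List.map (λ a → G (leading a)) (allVectors m)) ≡ G nothing + ∑ (λ j → G (just j) * weight j)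
  count-by-leading zero    G = refl
  count-by-leading (suc m) G = begin
    sum (List.map (λ a → G (leading a)) (allVectors (suc m)))
      ≡⟨ sum-cartesianProduct _∷_ (λ a → G (leading a)) elements (allVectors m) ⟩
    sum (List.map (λ x → sum (List.map (λ a → G (extendLeading x (leading a))) (allVectors m))) elements)
      ≡⟨ cong sum (ListP.map-cong (λ x → count-by-leading m (λ r → G (extendLeading x r))) elements) ⟩
    sum (List.map (λ x → G (leadingHead x) + S) elements)
      ≡⟨ sum-map-+ (λ x → G (leadingHead x)) S elements ⟩
    sum (List.map (λ x → G (leadingHead x)) elements) + q * S
      ≡⟨ cong₂ _+_ (sum-leadingHead G elements elements-unique (elements-complete 0#)) q*S ⟩
    G nothing + (q ∸ 1) * G (just Fin.zero) + ∑ (λ j → G (just (Fin.suc j)) * weight (Fin.suc j))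
      ≡⟨ rearrange (G nothing) (q ∸ 1) (G (just Fin.zero)) _ ⟩
    G nothing + ∑ (λ j → G (just j) * weight j) ∎
    where
    open ≡-Reasoning
    S : ℕ
    S = ∑ {m} (λ j → G (just (Fin.suc j)) * weight j)
    q*S : q * S ≡ ∑ (λ j → G (just (Fin.suc j)) * weight (Fin.suc j))
    q*S = trans (*-distribˡ-sum {m} q _) (sum-cong-≗ {m} (λ j → shift q (q ∸ 1) (G (just (Fin.suc j))) (q ^ toℕ j)))
      where
      shift : ∀ q r g p → q * (g * (r * p)) ≡ g * (r * (q * p))
      shift = solve-∀
    rearrange : ∀ h r g t → h + r * g + t ≡ h + (g * (r * 1) + t)
    rearrange = solve-∀

-- Fractions x / d of natural numbers.  Their equalities are checked in the
-- unnormalised rationals, where they become integer identities.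
module Fractions where
  open Nat using (_+_; _*_)
  open ℤ using (+_)

  /-≡ : ∀ x y d e .{{_ : NonZero d}} .{{_ : NonZero e}} → x * e ≡ y * d → (+ x) / d ≡ (+ y) / e
  /-≡ x y (suc d) (suc e) xe≡yd =
    ℚP.fromℚᵘ-cong {mkℚᵘ (+ x) d} {mkℚᵘ (+ y) e}
      (ℚᵘ.*≡* (trans (sym (ℤP.pos-* x (suc e))) (trans (cong +_ xe≡yd) (ℤP.pos-* y (suc d)))))

  private
    fromℚᵘ-≃ : ∀ (p : ℚ) (u : ℚᵘ) → toℚᵘ p ℚᵘ.≃ u → p ≡ fromℚᵘ u
    fromℚᵘ-≃ p u p≃u = trans (sym (ℚP.fromℚᵘ-toℚᵘ p)) (ℚP.fromℚᵘ-cong p≃u)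

    toℚᵘ-/ : ∀ x d → toℚᵘ ((+ x) / suc d) ℚᵘ.≃ mkℚᵘ (+ x) d
    toℚᵘ-/ x d = ℚP.toℚᵘ-fromℚᵘ (mkℚᵘ (+ x) d)

  /-+ : ∀ x y d .{{_ : NonZero d}} → (+ x) / d ℚ.+ (+ y) / d ≡ (+ (x + y)) / d
  /-+ x y (suc d) = fromℚᵘ-≃ _ (mkℚᵘ (+ (x + y)) d)
    (ℚᵘP.≃-trans (ℚP.toℚᵘ-homo-+ ((+ x) / suc d) ((+ y) / suc d))
    (ℚᵘP.≃-trans (ℚᵘP.+-cong (toℚᵘ-/ x d) (toℚᵘ-/ y d)) (ℚᵘ.*≡* cross)))
    where
    D : ℤ.ℤ
    D = + suc d
    factor : ∀ X Y D → (X ℤ.* D ℤ.+ Y ℤ.* D) ℤ.* D ≡ (X ℤ.+ Y) ℤ.* (D ℤ.* D)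
    factor = ℤSolver.solve-∀
    cross : ((+ x) ℤ.* D ℤ.+ (+ y) ℤ.* D) ℤ.* D ≡ (+ (x + y)) ℤ.* (+ (suc d * suc d))
    cross = trans (factor (+ x) (+ y) D) (sym (cong₂ ℤ._*_ (ℤP.pos-+ x y) (ℤP.pos-* (suc d) (suc d))))

  /-* : ∀ x y d e .{{_ : NonZero d}} .{{_ : NonZero e}} →
        ((+ x) / d) ℚ.* ((+ y) / e) ≡ ((+ (x * y)) / (d * e)) {{ℕP.m*n≢0 d e}}
  /-* x y (suc d) (suc e) = fromℚᵘ-≃ _ ((+ (x * y)) ℚᵘ./ (suc d * suc e))
    (ℚᵘP.≃-trans (ℚP.toℚᵘ-homo-* ((+ x) / suc d) ((+ y) / suc e))
    (ℚᵘP.≃-trans (ℚᵘP.*-cong (toℚᵘ-/ x d) (toℚᵘ-/ y e))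
                 (ℚᵘ.*≡* (cong (ℤ._* (+ (suc d * suc e))) (sym (ℤP.pos-* x y))))))

  open import Algebra.Properties.Semiring.Sum ℕP.+-*-semiring using () renaming (sum to ∑ℕ)
  open import Algebra.Properties.Monoid.Sum ℚP.+-0-monoid using () renaming (sum to ∑ℚ)

  /-∑ : ∀ {m} (g : Fin m → ℕ) D .{{_ : NonZero D}} → (+ ∑ℕ g) / D ≡ ∑ℚ (λ k → (+ g k) / D)
  /-∑ {zero}  g D = ℚP.0/n≡0 D
  /-∑ {suc m} g D =
    trans (sym (/-+ (g Fin.zero) _ D)) (cong ((+ g Fin.zero) / D ℚ.+_) (/-∑ (λ k → g (Fin.suc k)) D))

-- One step of the backward juggling chain from s, with coin parameter q:
-- its transition probabilities are counts divided by q^b.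
module ChainProbabilities (q : ℕ) .{{q≢0 : NonZero q}} where
  open Nat using (_+_; _*_)
  open ℤ using (+_)
  open Chain q
  open Fractions
  open import Algebra.Properties.Semiring.Sum ℕP.+-*-semiring using (sum-permute) renaming (sum to ∑ℕ)
  open import Algebra.Properties.Monoid.Sum ℚP.+-0-monoid as ℚΣ using () renaming (sum to ∑ℚ)

  q^k≢0 : ∀ k → NonZero (q ^ k)
  q^k≢0 k = ℕP.m^n≢0 q k

  infix 7 _/q^_
  _/q^_ : ℕ → ℕ → ℚ
  x /q^ k = ((+ x) / q ^ k) {{q^k≢0 k}}

  h^k : ∀ k → powℚ h k ≡ 1 /q^ k
  h^k zero    = refl
  h^k (suc k) = trans (cong (h ℚ.*_) (h^k k)) (/-* 1 1 q (q ^ k) {{q≢0}} {{q^k≢0 k}})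

  1-h : 1ℚ ℚ.- h ≡ (+ (q ∸ 1)) / q
  1-h = begin
    1ℚ ℚ.- h              ≡⟨ cong (ℚ._- h) (sym [q-1]/q+h≡1) ⟩
    ([q-1]/q ℚ.+ h) ℚ.- h ≡⟨ ℚP.+-assoc [q-1]/q h (ℚ.- h) ⟩
    [q-1]/q ℚ.+ (h ℚ.- h) ≡⟨ cong ([q-1]/q ℚ.+_) (ℚP.+-inverseʳ h) ⟩
    [q-1]/q ℚ.+ 0ℚ        ≡⟨ ℚP.+-identityʳ [q-1]/q ⟩
    [q-1]/q               ∎
    where
    open ≡-Reasoning
    [q-1]/q : ℚ
    [q-1]/q = (+ (q ∸ 1)) / q
    [q-1]/q+h≡1 : [q-1]/q ℚ.+ h ≡ 1ℚ
    [q-1]/q+h≡1 = trans (/-+ (q ∸ 1) 1 q)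
      (/-≡ (q ∸ 1 + 1) 1 q 1
        (trans (ℕP.*-identityʳ _) (trans (ℕP.m∸n+n≡m (Nat.>-nonZero⁻¹ q)) (sym (ℕP.*-identityˡ q)))))

  tails-at : ∀ b k → k < b → powℚ h k ℚ.* (1ℚ ℚ.- h) ≡ ((q ∸ 1) * q ^ (b ∸ suc k)) /q^ b
  tails-at b k k<b = begin
    powℚ h k ℚ.* (1ℚ ℚ.- h)               ≡⟨ cong₂ ℚ._*_ (h^k k) 1-h ⟩
    (1 /q^ k) ℚ.* ((+ (q ∸ 1)) / q)       ≡⟨ /-* 1 (q ∸ 1) (q ^ k) q {{q^k≢0 k}} ⟩
    ((+ (1 * (q ∸ 1))) / (q ^ k * q)) {{q^k*q≢0}}
      ≡⟨ /-≡ (1 * (q ∸ 1)) ((q ∸ 1) * q ^ j) (q ^ k * q) (q ^ b) {{q^k*q≢0}} {{q^k≢0 b}} cross ⟩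
    ((q ∸ 1) * q ^ j) /q^ b               ∎
    where
    open ≡-Reasoning
    j : ℕ
    j = b ∸ suc k
    q^k*q≢0 : NonZero (q ^ k * q)
    q^k*q≢0 = ℕP.m*n≢0 (q ^ k) q {{q^k≢0 k}}
    q^b : q ^ b ≡ q * q ^ k * q ^ j
    q^b = trans (cong (q ^_) (sym (ℕP.m+[n∸m]≡n k<b))) (ℕP.^-distribˡ-+-* q (suc k) j)
    regroup : ∀ r Q P q → 1 * r * (q * Q * P) ≡ r * P * (Q * q)
    regroup = solve-∀
    cross : 1 * (q ∸ 1) * q ^ b ≡ (q ∸ 1) * q ^ j * (q ^ k * q)
    cross = trans (cong (1 * (q ∸ 1) *_) q^b) (regroup (q ∸ 1) (q ^ k) (q ^ j) q)

  landing : ∀ {m} → Vec ℕ m → ℚ × Vec ℕ m → ℚ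
  landing τ (p , u) = if does (VecP.≡-dec Nat._≟_ u τ) then p else 0ℚ

  stepProb-unfold : ∀ {m} (s : Vec ℕ m) ls τ lt →
                    stepProb (s , ls) (τ , lt) ≡ List.foldr ℚ._+_ 0ℚ (List.map (landing τ) (outcomes s))
  stepProb-unfold s ls τ lt = trans (proj₂ unfolded) (foldr-map-cong (outcomes s))
    where
    unfolded : Σ (ℚ × Vec ℕ _ → ℚ) λ G →
               stepProb (s , ls) (τ , lt) ≡ List.foldr ℚ._+_ 0ℚ (List.map G (outcomes s))
    unfolded = _ , refl
    summand≡landing : ∀ o → proj₁ unfolded o ≡ landing τ o
    summand≡landing (p , u) with VecP.≡-dec Nat._≟_ u τ
    ... | yes _ = refl
    ... | no _  = refl
    foldr-map-cong : ∀ os → List.foldr ℚ._+_ 0ℚ (List.map (proj₁ unfolded) os)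
                          ≡ List.foldr ℚ._+_ 0ℚ (List.map (landing τ) os)
    foldr-map-cong List.[]        = refl
    foldr-map-cong (o List.∷ os) = cong₂ ℚ._+_ (summand≡landing o) (foldr-map-cong os)

  foldr-tabulate : ∀ {A : Set} {m} (H : A → ℚ) (f : Fin m → A) →
                   List.foldr ℚ._+_ 0ℚ (List.map H (Vec.toList (Vec.tabulate f))) ≡ ∑ℚ (λ k → H (f k))
  foldr-tabulate {m = zero}  H f = refl
  foldr-tabulate {m = suc m} H f = cong (H (f Fin.zero) ℚ.+_) (foldr-tabulate H (λ k → f (Fin.suc k)))

  -- the transition probability s → τ is a count of coefficient-vector
  -- shapes divided by q^b: one for "all heads", (q - 1) q^(b-1-k) for
  -- "first tails on flip k+1"
  stepProb-as-count : ∀ {n} (s : Vec ℕ (suc n)) ls τ lt →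
    stepProb (s , ls) (τ , lt) ≡ (hits s τ nothing + ∑ℕ (λ j → hits s τ (just j) * leadingWeight q j)) /q^ suc n
  stepProb-as-count {n} s ls τ lt = sym (begin
    (hits s τ nothing + ∑ℕ g) /q^ b
      ≡⟨ sym (/-+ (hits s τ nothing) (∑ℕ g) (q ^ b) {{q^k≢0 b}}) ⟩
    hits s τ nothing /q^ b ℚ.+ ∑ℕ g /q^ b
      ≡⟨ cong (hits s τ nothing /q^ b ℚ.+_) (cong (_/q^ b) (sum-permute g Perm.reverse)) ⟩
    hits s τ nothing /q^ b ℚ.+ ∑ℕ (λ k → g (opposite k)) /q^ b
      ≡⟨ cong₂ ℚ._+_ all-heads
           (trans (/-∑ (λ k → g (opposite k)) (q ^ b) {{q^k≢0 b}}) (ℚΣ.sum-cong-≗ first-tails)) ⟩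
    landing τ (powℚ h b , Vec.map suc s) ℚ.+ ∑ℚ (λ k → landing τ (tails k))
      ≡⟨ cong (landing τ (powℚ h b , Vec.map suc s) ℚ.+_) (sym (foldr-tabulate (landing τ) tails)) ⟩
    List.foldr ℚ._+_ 0ℚ (List.map (landing τ) (outcomes s))
      ≡⟨ sym (stepProb-unfold s ls τ lt) ⟩
    stepProb (s , ls) (τ , lt) ∎)
    where
    open ≡-Reasoning
    b : ℕ
    b = suc n
    g : Fin b → ℕ
    g j = hits s τ (just j) * leadingWeight q j
    tails : Fin b → ℚ × Vec ℕ b
    tails k = powℚ h (toℕ k) ℚ.* (1ℚ ℚ.- h) , 0 ∷ Vec.map suc (removeAt s (opposite k))
    all-heads : hits s τ nothing /q^ b ≡ landing τ (powℚ h b , Vec.map suc s)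
    all-heads with VecP.≡-dec Nat._≟_ (Vec.map suc s) τ
    ... | yes _ = sym (h^k b)
    ... | no _  = ℚP.0/n≡0 (q ^ b) {{q^k≢0 b}}
    first-tails : ∀ k → g (opposite k) /q^ b ≡ landing τ (tails k)
    first-tails k with VecP.≡-dec Nat._≟_ (0 ∷ Vec.map suc (removeAt s (opposite k))) τ
    ... | yes _ = trans (cong (_/q^ b) count) (sym (tails-at b (toℕ k) (FinP.toℕ<n k)))
      where
      count : 1 * leadingWeight q (opposite k) ≡ (q ∸ 1) * q ^ (b ∸ suc (toℕ k))
      count = trans (ℕP.*-identityˡ _) (cong (λ e → (q ∸ 1) * q ^ e) (FinP.opposite-prop k))
    ... | no _  = ℚP.0/n≡0 (q ^ b) {{q^k≢0 b}}

-- For M ∈ U_b with pivot list s and a target state τ, the columns c with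
-- σ([c M]) = τ are exactly the images Φ a of the coefficient vectors a with
-- nextState s (leading a) = τ; there are as many as stepProb counts.
module Transition (F : FiniteField) (n : ℕ) (M : LinAlg.Matrix F (suc n)) (M∈U : LinAlg.InU F (suc n) M)
                  (s : Vec ℕ (suc n)) (s-increasing : Increasing s)
                  (s-pivots : ∀ t → LinAlg.σ F (suc n) M t ⇔ (t ∈ᵥ s))
                  (τ : Vec ℕ (suc n)) (τ-increasing : Increasing τ) where
  open Nat using (_+_; _*_)
  open FiniteField F using (Carrier; q)
  open LinAlg F (suc n)
  open Vectors F using (allVectors; allVectors-complete; allVectors-unique)
  open LeadingIndex F
  open PivotBasis F n M s s-increasing s-pivots
  open Counting F
  open import Algebra.Properties.Semiring.Sum ℕP.+-*-semiring using () renaming (sum to ∑ℕ)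

  reaches? : Decidable (λ (a : Vec Carrier (suc n)) → nextState s (leading a) ≡ τ)
  reaches? a = VecP.≡-dec Nat._≟_ (nextState s (leading a)) τ

  targets : List Column
  targets = List.map Φ (filter reaches? (allVectors (suc n)))

  targets-unique : Unique targets
  targets-unique = UniqueP.map⁺ (Φ-injective _ _) (UniqueP.filter⁺ reaches? (allVectors-unique (suc n)))

  targets-exact : ∀ c → (∀ t → σ (cons c M) t ⇔ (t ∈ᵥ τ)) ⇔ (c ∈ targets)
  targets-exact c = mk⇔ to from
    where
    to : (∀ t → σ (cons c M) t ⇔ (t ∈ᵥ τ)) → c ∈ targets
    to c-reaches with Φ-surjective M∈U c
    ... | a , refl = ∈-map⁺ₗ Φ (∈-filter⁺ reaches? (allVectors-complete a)
          (increasing-unique _ τ (increasing-nextState s (leading a) s-increasing) τ-increasing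
             (λ t → c-reaches t ⇔-∘ ⇔-sym (pivots-cons a t))))
    from : c ∈ targets → ∀ t → σ (cons c M) t ⇔ (t ∈ᵥ τ)
    from c∈ with ∈-map⁻ₗ Φ c∈
    ... | a , a∈ , refl with ∈-filter⁻ reaches? {xs = allVectors (suc n)} a∈
    ... | _ , reaches = λ t → subst (λ v → σ (cons (Φ a) M) t ⇔ (t ∈ᵥ v)) reaches (pivots-cons a t)

  targets-count : length targets ≡ hits s τ nothing + ∑ℕ (λ j → hits s τ (just j) * leadingWeight q j)
  targets-count = begin
    length targets
      ≡⟨ ListP.length-map Φ (filter reaches? (allVectors (suc n))) ⟩
    length (filter reaches? (allVectors (suc n)))
      ≡⟨ length-filter reaches? (allVectors (suc n)) ⟩
    sum (List.map (λ a → hits s τ (leading a)) (allVectors (suc n)))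
      ≡⟨ count-by-leading (suc n) (hits s τ) ⟩
    hits s τ nothing + ∑ℕ (λ j → hits s τ (just j) * leadingWeight q j) ∎
    where open ≡-Reasoning

proposition2p1 : (F : FiniteField) (b : ℕ) → 1 ≤ b →
    let open FiniteField F
        open LinAlg F b
        open Chain q {{q-nonZero F}}
    in (M : Matrix) → InU M →
       ((c : Vec Carrier b) → InU (cons c M) × Edge (σ (cons c M)) (σ M))
       × ((s : JState b) → Represents (σ M) s → (τ : JState b) →
            UniformProb (λ c → Represents (σ (cons c M)) τ) (stepProb s τ))
proposition2p1 F zero    ()
proposition2p1 F (suc n) _ M M∈U =
  (λ c → cons-InU M∈U , cons-edge) ,
  λ { (s , s-linked) s-pivots (τ , τ-linked) →
      let open Transition F n M M∈U s (linked⇒increasing s-linked) s-pivots τ (linked⇒increasing τ-linked)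
      in length targets , (targets , targets-unique , refl , targets-exact) ,
         trans (cong (_/q^ suc n) targets-count) (sym (stepProb-as-count s s-linked τ τ-linked)) }
  where
  open Prepend F (suc n)
  open ChainProbabilities (FiniteField.q F) {{q-nonZero F}}
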